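{- Let $R^1,R^2,S^1,S^2\in\mathfrak{P}$ with $R^1\cap R^2=\emptyset$ and $S^1\cap S^2=\emptyset$. Then: if $R^1\sqsubseteq S^1$ and $R^2\sqsubseteq S^2$, then $R^1+R^2\sqsubseteq S^1+S^2$; if $R^1\sqsubseteq_G S^1$ and $R^2\sqsubseteq_G S^2$, then $R^1+R^2\sqsubseteq_G S^1+S^2$; if $R^1\sqsubseteq_I S^1$ and $R^2\sqsubseteq_I S^2$, then $R^1+R^2\sqsubseteq_I S^1+S^2$.
   Context: $\mathfrak{P}$ is the class of finite nonempty posets and $\mathfrak{P}_r$ a fixed system of representatives of its isomorphism classes. $A+B$ is the direct sum of disjoint posets (disjoint union, no comparabilities between summands). $\mathcal{H}(P,Q)$ is the set of order-preserving maps $P\to Q$. For $A\subseteq P$, $x\in A$: $\gamma_A(x)$ is the set of $y\in A$ joined to $x$ by a sequence $x=z_0,\dots,z_L=y$ in $A$ ($L\ge0$) with consecutive elements strictly comparable; for a map $\xi$ on $P$, $G_\xi(x):=\gamma_{\xi^{ -1}(\xi(x))}(x)$. For $A\subseteq P$, ${\downarrow^{\circ}}A:=\{y: y\le a\text{ for some }a\in A\}\setminus A$, ${\uparrow_{\circ}}A:=\{y: y\ge a\text{ for some }a\in A\}\setminus A$. The EV-system $\mathcal{E}(P)$ is the set of triples $(x,D,U)$ with $x\in P$, $D\subseteq{\downarrow^{\circ}}\{x\}$, $U\subseteq{\uparrow_{\circ}}\{x\}$; $\mathfrak a<_+\mathfrak b$ iff $\mathfrak a_1\in\mathfrak b_2$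 and $\mathfrak b_1\in\mathfrak a_3$; $\le_+$ is $<_+$ plus equality. For $\xi\in\mathcal{H}(P,Q)$, $\alpha_{P,\xi}(x):=(\xi(x),\xi({\downarrow^{\circ}}G_\xi(x)),\xi({\uparrow_{\circ}}G_\xi(x)))$. A Hom-scheme from $R$ to $S$ is a family $(\rho_P)_{P\in\mathfrak{P}_r}$ of maps $\rho_P:\mathcal{H}(P,R)\to\mathcal{H}(P,S)$; strong if every $\rho_P$ is injective; a G-scheme if $G_{\rho_P(\xi)}(x)=G_\xi(x)$ for all $P,\xi,x$; an I-scheme if for all $P,P'\in\mathfrak{P}_r$, $\xi\in\mathcal{H}(P,R)$, $\zeta\in\mathcal{H}(P',R)$, $x\in P$, $y\in P'$: $\alpha_{P,\xi}(x)\le_+\alpha_{P',\zeta}(y)$ implies $\alpha_{P,\rho_P(\xi)}(x)\le_+\alpha_{P',\rho_{P'}(\zeta)}(y)$, with $<_+$ preserved. $R\sqsubseteq S$, $R\sqsubseteq_G S$, $R\sqsubseteq_I S$ mean existence of a strong Hom-scheme, strong G-scheme, strong I-scheme from $R$ to $S$, respectively. -}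

module Defs where

open import Level using (Level; 0ℓ)
open import Data.Nat using (ℕ; suc; _+_)
open import Data.Fin using (Fin)
open import Data.Fin.Properties using (+↔⊎)
open import Data.Product using (Σ; ∃; _×_; _,_; proj₁; proj₂)
open import Data.Sum using (_⊎_; inj₁; inj₂)
open import Data.Empty using (⊥)
open import Relation.Nullary using (¬_)
open import Relation.Binary.Core using (Rel)
open import Relation.Binary.Structures using (IsPartialOrder; IsPreorder; IsEquivalence)
open import Relation.Binary.PropositionalEquality using (_≡_; _≢_; refl; cong; isEquivalence)
open import Function.Bundles using (_↔_; Inverse)
open import Function.Properties.Inverse using (↔-sym; ↔-trans)
open import Data.Sum.Function.Propositional using (_⊎-↔_)

-- Finite nonempty posets (the class 𝔓).  Equality on the carrier is
-- propositional equality; finiteness/nonemptiness is a bijection with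
-- Fin (suc k) for some k.

record FinPoset : Set₁ where
  field
    Carrier        : Set
    _≤_            : Rel Carrier 0ℓ
    isPartialOrder : IsPartialOrder _≡_ _≤_
    pred-size      : ℕ
    enum           : Carrier ↔ Fin (suc pred-size)

  _<_ : Rel Carrier 0ℓ
  x < y = (x ≤ y) × (x ≢ y)

open FinPoset public using () renaming (Carrier to ∣_∣)

record Iso (P Q : FinPoset) : Set where
  module P = FinPoset P
  module Q = FinPoset Q
  field
    bij      : P.Carrier ↔ Q.Carrier
    mono     : ∀ {x y} → x P.≤ y → Inverse.to bij x Q.≤ Inverse.to bij y
    reflects : ∀ {x y} → Inverse.to bij x Q.≤ Inverse.to bij y → x P.≤ y

record RepSystem : Set₂ where
  field
    Index  : Set₁
    Rep    : Index → FinPoset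
    cover  : (P : FinPoset) → Σ Index λ i → Iso (Rep i) P
    unique : (P : FinPoset) (i j : Index) → Iso (Rep i) P → Iso (Rep j) P → i ≡ j

-- Direct sum A + B of posets (disjoint union, no comparabilities
-- between the summands).  Disjointness is built in via the sum type.

data SumLe {A B : Set} (_≤₁_ : Rel A 0ℓ) (_≤₂_ : Rel B 0ℓ) : Rel (A ⊎ B) 0ℓ where
  le₁ : ∀ {x y} → x ≤₁ y → SumLe _≤₁_ _≤₂_ (inj₁ x) (inj₁ y)
  le₂ : ∀ {x y} → x ≤₂ y → SumLe _≤₁_ _≤₂_ (inj₂ x) (inj₂ y)

_⊕_ : FinPoset → FinPoset → FinPoset
P ⊕ Q = record
  { Carrier        = P.Carrier ⊎ Q.Carrier
  ; _≤_            = SumLe P._≤_ Q._≤_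
  ; isPartialOrder = record
      { isPreorder = record
          { isEquivalence = isEquivalence
          ; reflexive     = rfl
          ; trans         = trn
          }
      ; antisym = ant
      }
  ; pred-size      = P.pred-size + suc Q.pred-size
  ; enum           = ↔-trans (P.enum ⊎-↔ Q.enum) (↔-sym +↔⊎)
  }
  where
  module P = FinPoset P
  module Q = FinPoset Q
  module PP = IsPartialOrder P.isPartialOrder
  module QP = IsPartialOrder Q.isPartialOrder
  rfl : ∀ {x y} → x ≡ y → SumLe P._≤_ Q._≤_ x y
  rfl {inj₁ x} refl = le₁ (PP.reflexive refl)
  rfl {inj₂ x} refl = le₂ (QP.reflexive refl)
  trn : ∀ {x y z} → SumLe P._≤_ Q._≤_ x y → SumLe P._≤_ Q._≤_ y z → SumLe P._≤_ Q._≤_ x z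
  trn (le₁ p) (le₁ q) = le₁ (PP.trans p q)
  trn (le₂ p) (le₂ q) = le₂ (QP.trans p q)
  ant : ∀ {x y} → SumLe P._≤_ Q._≤_ x y → SumLe P._≤_ Q._≤_ y x → x ≡ y
  ant (le₁ p) (le₁ q) = cong inj₁ (PP.antisym p q)
  ant (le₂ p) (le₂ q) = cong inj₂ (QP.antisym p q)

Subset : Set → Set₁
Subset A = A → Set

_≐_ : {A : Set} → Subset A → Subset A → Set
X ≐ Y = ∀ a → (X a → Y a) × (Y a → X a)

image : {A B : Set} → (A → B) → Subset A → Subset B
image ξ X b = ∃ λ a → X a × (ξ a ≡ b)

record Hom (P Q : FinPoset) : Set where
  module P = FinPoset P
  module Q = FinPoset Q
  field
    fun  : P.Carrier → Q.Carrier
    mono : ∀ {x y} → x P.≤ y → fun x Q.≤ fun y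

open Hom public using (fun)

_≗ₕ_ : {P Q : FinPoset} → Hom P Q → Hom P Q → Set
ξ ≗ₕ ζ = ∀ x → fun ξ x ≡ fun ζ x

module _ (P : FinPoset) where
  open FinPoset P

  data Chain (A : Subset Carrier) (x : Carrier) : Carrier → Set where
    start : A x → Chain A x x
    step  : ∀ {z y} → Chain A x z → A y → (z < y ⊎ y < z) → Chain A x y

  γ : Subset Carrier → Carrier → Subset Carrier
  γ A x = Chain A x

  ↓° : Subset Carrier → Subset Carrier
  ↓° A y = (∃ λ a → A a × (y ≤ a)) × ¬ A y

  ↑° : Subset Carrier → Subset Carrier
  ↑° A y = (∃ λ a → A a × (a ≤ y)) × ¬ A y

G : (P : FinPoset) {B : Set} → (∣ P ∣ → B) → ∣ P ∣ → Subset ∣ P ∣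
G P ξ x = γ P (λ z → ξ z ≡ ξ x) x

Triple : Set → Set₁
Triple A = A × Subset A × Subset A

_<₊_ : {A : Set} → Triple A → Triple A → Set
(a₁ , a₂ , a₃) <₊ (b₁ , b₂ , b₃) = b₂ a₁ × a₃ b₁

_≡₊_ : {A : Set} → Triple A → Triple A → Set
(a₁ , a₂ , a₃) ≡₊ (b₁ , b₂ , b₃) = (a₁ ≡ b₁) × (a₂ ≐ b₂) × (a₃ ≐ b₃)

_≤₊_ : {A : Set} → Triple A → Triple A → Set
a ≤₊ b = (a <₊ b) ⊎ (a ≡₊ b)

α : (P Q : FinPoset) → Hom P Q → ∣ P ∣ → Triple ∣ Q ∣
α P Q ξ x = fun ξ x
          , image (fun ξ) (↓° P (G P (fun ξ) x))
          , image (fun ξ) (↑° P (G P (fun ξ) x))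

module _ (𝔓r : RepSystem) where
  open RepSystem 𝔓r

  record HomScheme (R S : FinPoset) : Set₁ where
    field
      ρ    : (i : Index) → Hom (Rep i) R → Hom (Rep i) S
      ρ-wd : (i : Index) (ξ ζ : Hom (Rep i) R) → ξ ≗ₕ ζ → ρ i ξ ≗ₕ ρ i ζ

  module _ {R S : FinPoset} (H : HomScheme R S) where
    open HomScheme H

    IsStrong : Set₁
    IsStrong = (i : Index) (ξ ζ : Hom (Rep i) R) → ρ i ξ ≗ₕ ρ i ζ → ξ ≗ₕ ζ

    IsGScheme : Set₁
    IsGScheme = (i : Index) (ξ : Hom (Rep i) R) (x : ∣ Rep i ∣)
              → G (Rep i) (fun (ρ i ξ)) x ≐ G (Rep i) (fun ξ) x

    IsIScheme : Set₁
    IsIScheme = (i j : Index) (ξ : Hom (Rep i) R) (ζ : Hom (Rep j) R)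
                (x : ∣ Rep i ∣) (y : ∣ Rep j ∣)
              → (α (Rep i) R ξ x ≤₊ α (Rep j) R ζ y
                   → α (Rep i) S (ρ i ξ) x ≤₊ α (Rep j) S (ρ j ζ) y)
              × (α (Rep i) R ξ x <₊ α (Rep j) R ζ y
                   → α (Rep i) S (ρ i ξ) x <₊ α (Rep j) S (ρ j ζ) y)

  _⊑_ : FinPoset → FinPoset → Set₁
  R ⊑ S = Σ (HomScheme R S) λ H → IsStrong H

  _⊑G_ : FinPoset → FinPoset → Set₁
  R ⊑G S = Σ (HomScheme R S) λ H → IsStrong H × IsGScheme H

  _⊑I_ : FinPoset → FinPoset → Set₁
  R ⊑I S = Σ (HomScheme R S) λ H → IsStrong H × IsIScheme H

-- A map ξ : P → R¹ + R² splits P into ξ⁻¹(R¹) and ξ⁻¹(R²), each a union of connected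
-- components of P. A nonempty part is isomorphic to a representative, where the restriction
-- of ξ is a map into Rᵏ to which ρᵏ applies; transporting back and gluing the two parts
-- defines ρ(ξ) into S¹ + S². As ρ(ξ) sends each part into the matching summand, ξ is
-- recovered from ρ(ξ) part by part. G_ξ(x) and α(x) only see the part containing x, so they
-- are those of the restricted map transported along the isomorphism: the G- and
-- I-conditions for ρᵏ carry over, and points of different parts are never ≤₊-related.

module Submission where

open import Defs
open import Level using (0ℓ)
open import Data.Nat using (ℕ; zero; suc; pred; NonZero)
open import Data.Nat.Properties using (suc-pred)
open import Data.Fin using (Fin; zero; suc; cast)
open import Data.Fin.Properties using (cast-involutive; nonZeroIndex)
open import Data.Bool using (Bool; true; false; T; not)
open import Data.Bool.Properties using (T-irrelevant)
open import Data.Vec using (Vec; []; _∷_; lookup; tabulate)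
open import Data.Vec.Properties using (lookup∘tabulate; tabulate-cong)
open import Data.Product as Product using (Σ; ∃; _×_; _,_; proj₁; proj₂)
open import Data.Sum as Sum using (_⊎_; inj₁; inj₂; [_,_]′; swap)
open import Data.Sum.Properties using (inj₁-injective; inj₂-injective; swap-involutive)
open import Data.Empty using (⊥-elim)
open import Function using (id; _∘_; flip)
open import Function.Bundles using (_↔_; Inverse; mk↔ₛ′)
open import Function.Properties.Inverse using (↔-trans)
open import Relation.Nullary using (¬_)
open import Relation.Binary.Core using (Rel)
open import Relation.Binary.Structures using (IsPartialOrder)
open import Relation.Binary.PropositionalEquality
  using (_≡_; _≢_; refl; sym; trans; cong; subst; subst₂; isEquivalence; module ≡-Reasoning)

-- Parts of a finite poset

count : ∀ {n} → Vec Bool n → ℕ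
count []          = zero
count (true ∷ w)  = suc (count w)
count (false ∷ w) = count w

Members : ∀ {n} → Vec Bool n → Set
Members {n} w = Σ (Fin n) λ k → T (lookup w k)

Members-≡ : ∀ {n} (w : Vec Bool n) {s s' : Members w} → proj₁ s ≡ proj₁ s' → s ≡ s'
Members-≡ w {k , t} {.k , t'} refl = cong (k ,_) (T-irrelevant t t')

Members↔count : ∀ {n} (w : Vec Bool n) → Members w ↔ Fin (count w)
Members↔count w = mk↔ₛ′ (index w) (member w) (index-member w) (member-index w)
  where
  index : ∀ {n} (w : Vec Bool n) → Members w → Fin (count w)
  index (true ∷ w)  (zero  , _) = zero
  index (true ∷ w)  (suc k , t) = suc (index w (k , t))
  index (false ∷ w) (zero  , ())
  index (false ∷ w) (suc k , t) = index w (k , t)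

  member : ∀ {n} (w : Vec Bool n) → Fin (count w) → Members w
  member (true ∷ w)  zero    = zero , _
  member (true ∷ w)  (suc i) = Product.map suc id (member w i)
  member (false ∷ w) i       = Product.map suc id (member w i)

  index-member : ∀ {n} (w : Vec Bool n) i → index w (member w i) ≡ i
  index-member (true ∷ w)  zero    = refl
  index-member (true ∷ w)  (suc i) = cong suc (index-member w i)
  index-member (false ∷ w) i       = index-member w i

  member-index : ∀ {n} (w : Vec Bool n) s → member w (index w s) ≡ s
  member-index (true ∷ w)  (zero  , _) = refl
  member-index (true ∷ w)  (suc k , t) = cong (Product.map suc id) (member-index w (k , t))
  member-index (false ∷ w) (zero  , ())
  member-index (false ∷ w) (suc k , t) = cong (Product.map suc id) (member-index w (k , t))

cast↔ : ∀ {m n} → .(m ≡ n) → Fin m ↔ Fin n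
cast↔ eq = mk↔ₛ′ (cast eq) (cast (sym eq)) (cast-involutive eq (sym eq)) (cast-involutive (sym eq) eq)

-- A part of P is a vector of booleans over the enumeration of P rather than a predicate:
-- pointwise equal maps then give propositionally equal parts, hence the same representative,
-- which is what makes the glued scheme respect ≗ₕ.
Selection : FinPoset → Set
Selection P = Vec Bool (suc (FinPoset.pred-size P))

module _ (P : FinPoset) where
  open FinPoset P
  private
    module O = IsPartialOrder isPartialOrder
    module E = Inverse enum

    from-injective : ∀ {k k'} → E.from k ≡ E.from k' → k ≡ k'
    from-injective {k} {k'} eq = begin
      k                ≡⟨ E.strictlyInverseˡ k ⟨
      E.to (E.from k)  ≡⟨ cong E.to eq ⟩
      E.to (E.from k') ≡⟨ E.strictlyInverseˡ k' ⟩
      k'               ∎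
      where open ≡-Reasoning

  Selected : Selection P → ∣ P ∣ → Set
  Selected w x = T (lookup w (E.to x))

  incl : {w : Selection P} → Members w → ∣ P ∣
  incl s = E.from (proj₁ s)

  -- The nonemptiness instance is irrelevant, so subposet P w (and its representative)
  -- does not depend on the point witnessing it.
  subposet : (w : Selection P) .⦃ _ : NonZero (count w) ⦄ → FinPoset
  subposet w = record
    { Carrier        = Members w
    ; _≤_            = λ s s' → incl {w} s ≤ incl {w} s'
    ; isPartialOrder = record
        { isPreorder = record
            { isEquivalence = isEquivalence
            ; reflexive     = λ { refl → O.reflexive refl }
            ; trans         = O.trans
            }
        ; antisym = λ s≤s' s'≤s → Members-≡ w (from-injective (O.antisym s≤s' s'≤s))
        }
    ; pred-size      = pred (count w)
    ; enum           = ↔-trans (Members↔count w) (cast↔ (sym (suc-pred (count w))))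
    }

≐-sym : {A : Set} {X Y : Subset A} → X ≐ Y → Y ≐ X
≐-sym X≐Y a = Product.swap (X≐Y a)

≐-trans : {A : Set} {X Y Z : Subset A} → X ≐ Y → Y ≐ Z → X ≐ Z
≐-trans X≐Y Y≐Z a = proj₁ (Y≐Z a) ∘ proj₁ (X≐Y a) , proj₂ (X≐Y a) ∘ proj₂ (Y≐Z a)

image-cong : {A B : Set} (f : A → B) {X Y : Subset A} → X ≐ Y → image f X ≐ image f Y
image-cong f X≐Y b = Product.map₂ (Product.map₁ (proj₁ (X≐Y _)))
                   , Product.map₂ (Product.map₁ (proj₂ (X≐Y _)))

image-square : {A B C D : Set} {e : A → B} {f : B → D} {g : A → C} {k : C → D} →
               (∀ a → f (e a) ≡ k (g a)) → {X : Subset A} → image f (image e X) ≐ image k (image g X)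
image-square {e = e} {g = g} square d
  = (λ { (_ , (a , x , refl) , refl) → g a , (a , x , refl) , sym (square a) })
  , (λ { (_ , (a , x , refl) , refl) → e a , (a , x , refl) , square a })

mapTriple : {A B : Set} → (A → B) → Triple A → Triple B
mapTriple f (a , D , U) = f a , image f D , image f U

≡₊-sym : {A : Set} {t u : Triple A} → t ≡₊ u → u ≡₊ t
≡₊-sym (a , D , U) = sym a , ≐-sym D , ≐-sym U

≡₊-trans : {A : Set} {t u v : Triple A} → t ≡₊ u → u ≡₊ v → t ≡₊ v
≡₊-trans (a , D , U) (a' , D' , U') = trans a a' , ≐-trans D D' , ≐-trans U U'

<₊-resp-≡₊ : {A : Set} {t t' u u' : Triple A} → t ≡₊ t' → u ≡₊ u' → t <₊ u → t' <₊ u'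
<₊-resp-≡₊ {t = t₁ , _} {t' = _ , _ , U'} {u = u₁ , _} {u' = _ , D' , _}
           (t₁≡ , _ , U≐) (u₁≡ , D≐ , _) (inD , inU)
  = subst D' t₁≡ (proj₁ (D≐ t₁) inD) , subst U' u₁≡ (proj₁ (U≐ u₁) inU)

≤₊-resp-≡₊ : {A : Set} {t t' u u' : Triple A} → t ≡₊ t' → u ≡₊ u' → t ≤₊ u → t' ≤₊ u'
≤₊-resp-≡₊ t≡ u≡ (inj₁ t<u) = inj₁ (<₊-resp-≡₊ t≡ u≡ t<u)
≤₊-resp-≡₊ t≡ u≡ (inj₂ t≡u) = inj₂ (≡₊-trans (≡₊-sym t≡) (≡₊-trans t≡u u≡))

mapTriple-<₊ : {A B : Set} (f : A → B) {t u : Triple A} → t <₊ u → mapTriple f t <₊ mapTriple f u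
mapTriple-<₊ f {t₁ , _} {u₁ , _} (inD , inU) = (t₁ , inD , refl) , (u₁ , inU , refl)

mapTriple-≤₊ : {A B : Set} (f : A → B) {t u : Triple A} → t ≤₊ u → mapTriple f t ≤₊ mapTriple f u
mapTriple-≤₊ f {t} {u} (inj₁ t<u) = inj₁ (mapTriple-<₊ f {t} {u} t<u)
mapTriple-≤₊ f (inj₂ (a , D , U)) = inj₂ (cong f a , image-cong f D , image-cong f U)

incomparable : {A A' : Set} {t u : Triple A} {t' u' : Triple A'} → ¬ (t ≤₊ u) →
               (t ≤₊ u → t' ≤₊ u') × (t <₊ u → t' <₊ u')
incomparable t≰u = (λ t≤u → ⊥-elim (t≰u t≤u)) , (λ t<u → ⊥-elim (t≰u (inj₁ t<u)))

module _ {A B : Set} {f : A → B} (f-injective : ∀ {a a'} → f a ≡ f a' → a ≡ a') where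

  image-reflects : {X : Subset A} {a : A} → image f X (f a) → X a
  image-reflects {X} (_ , x , fa'≡fa) = subst X (f-injective fa'≡fa) x

  image-cong-reflects : {X Y : Subset A} → image f X ≐ image f Y → X ≐ Y
  image-cong-reflects fX≐fY a = image-reflects ∘ (λ x → proj₁ (fX≐fY (f a)) (a , x , refl))
                              , image-reflects ∘ (λ y → proj₂ (fX≐fY (f a)) (a , y , refl))

  mapTriple-<₊-reflects : {t u : Triple A} → mapTriple f t <₊ mapTriple f u → t <₊ u
  mapTriple-<₊-reflects {_ , _ , U} {_ , D , _} (inD , inU) = image-reflects {D} inD , image-reflects {U} inU

  mapTriple-≤₊-reflects : {t u : Triple A} → mapTriple f t ≤₊ mapTriple f u → t ≤₊ u
  mapTriple-≤₊-reflects {t} {u} (inj₁ t<u) = inj₁ (mapTriple-<₊-reflects {t} {u} t<u)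
  mapTriple-≤₊-reflects (inj₂ (a , D , U)) =
    inj₂ (f-injective a , image-cong-reflects D , image-cong-reflects U)

≤₊-disjoint : {A B C : Set} {f : A → C} {g : B → C} → (∀ a b → f a ≢ g b) →
              {t u : Triple C} {t' : Triple A} {u' : Triple B} →
              t ≡₊ mapTriple f t' → u ≡₊ mapTriple g u' → ¬ (t ≤₊ u)
≤₊-disjoint disjoint {t₁ , _} {t' = t'₁ , _} (t₁≡ , _) (_ , D≐ , _) (inj₁ (inD , _))
  with proj₁ (D≐ t₁) inD
... | b , _ , gb≡t₁ = disjoint t'₁ b (trans (sym t₁≡) (sym gb≡t₁))
≤₊-disjoint disjoint {t' = t'₁ , _} {u' = u'₁ , _} (t₁≡ , _) (u₁≡ , _) (inj₂ (t₁≡u₁ , _))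
  = disjoint t'₁ u'₁ (trans (sym t₁≡) (trans t₁≡u₁ u₁≡))

isLeft : {A B : Set} → A ⊎ B → Bool
isLeft (inj₁ _) = true
isLeft (inj₂ _) = false

fromLeft : {A B : Set} (a : A ⊎ B) → T (isLeft a) → A
fromLeft (inj₁ a) _ = a

inj₁-fromLeft : {A B : Set} (a : A ⊎ B) (t : T (isLeft a)) → inj₁ (fromLeft a t) ≡ a
inj₁-fromLeft (inj₁ _) _ = refl

isLeft-swap : {A B : Set} (a : A ⊎ B) → isLeft (swap a) ≡ not (isLeft a)
isLeft-swap (inj₁ _) = refl
isLeft-swap (inj₂ _) = refl

isLeft⊎isLeft-swap : {A B : Set} (a : A ⊎ B) → T (isLeft a) ⊎ T (isLeft (swap a))
isLeft⊎isLeft-swap (inj₁ _) = inj₁ _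
isLeft⊎isLeft-swap (inj₂ _) = inj₂ _

isLeft-true : {A B : Set} {a : A ⊎ B} → T (isLeft a) → isLeft a ≡ true
isLeft-true {a = inj₁ _} _ = refl

isLeft-swap-true : {A B : Set} {a : A ⊎ B} → T (isLeft (swap a)) → isLeft a ≡ false
isLeft-swap-true {a = inj₂ _} _ = refl

¬isLeft×isLeft-swap : {A B : Set} (a : A ⊎ B) → T (isLeft a) → ¬ T (isLeft (swap a))
¬isLeft×isLeft-swap (inj₁ _) _ ()

swap-injective : {A B : Set} {a b : A ⊎ B} → swap a ≡ swap b → a ≡ b
swap-injective {a = a} {b} eq = trans (sym (swap-involutive a)) (trans (cong swap eq) (swap-involutive b))

module _ {A B : Set} {_≤₁_ : Rel A 0ℓ} {_≤₂_ : Rel B 0ℓ} where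

  SumLe-isLeft : ∀ {a b} → SumLe _≤₁_ _≤₂_ a b → isLeft a ≡ isLeft b
  SumLe-isLeft (le₁ _) = refl
  SumLe-isLeft (le₂ _) = refl

  fromLeft-mono : ∀ {a b} → SumLe _≤₁_ _≤₂_ a b → (t : T (isLeft a)) (t' : T (isLeft b)) →
                  fromLeft a t ≤₁ fromLeft b t'
  fromLeft-mono (le₁ a≤b) _ _ = a≤b

  SumLe-swap : ∀ {a b} → SumLe _≤₁_ _≤₂_ a b → SumLe _≤₂_ _≤₁_ (swap a) (swap b)
  SumLe-swap (le₁ a≤b) = le₂ a≤b
  SumLe-swap (le₂ a≤b) = le₁ a≤b

swapHom : {P R R' : FinPoset} → Hom P (R ⊕ R') → Hom P (R' ⊕ R)
swapHom ξ = record { fun = swap ∘ fun ξ ; mono = SumLe-swap ∘ Hom.mono ξ }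

isLeft-comparable : {P R R' : FinPoset} (ξ : Hom P (R ⊕ R')) {x y : ∣ P ∣} →
                    FinPoset._≤_ P x y ⊎ FinPoset._≤_ P y x → isLeft (fun ξ x) ≡ isLeft (fun ξ y)
isLeft-comparable ξ (inj₁ x≤y) = SumLe-isLeft (Hom.mono ξ x≤y)
isLeft-comparable ξ (inj₂ y≤x) = sym (SumLe-isLeft (Hom.mono ξ y≤x))

-- α P Q ξ = evTriple P (fun ξ).
evTriple : (P : FinPoset) {B : Set} → (∣ P ∣ → B) → ∣ P ∣ → Triple B
evTriple P φ x = φ x , image φ (↓° P (G P φ x)) , image φ (↑° P (G P φ x))

-- ↓° P X = Frontier _≤_ X and ↑° P X = Frontier (flip _≤_) X hold definitionally.
Frontier : {A : Set} → Rel A 0ℓ → Subset A → Subset A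
Frontier _⊲_ X y = (∃ λ a → X a × (y ⊲ a)) × ¬ X y

-- e-closed: the image of e is a union of connected components of P.
module ComponentEmbedding (P Q : FinPoset) (e : ∣ Q ∣ → ∣ P ∣)
  (e-mono     : ∀ {q q'} → FinPoset._≤_ Q q q' → FinPoset._≤_ P (e q) (e q'))
  (e-reflects : ∀ {q q'} → FinPoset._≤_ P (e q) (e q') → FinPoset._≤_ Q q q')
  (e-closed   : ∀ {q y} → FinPoset._≤_ P (e q) y ⊎ FinPoset._≤_ P y (e q) → ∃ λ q' → e q' ≡ y)
  where
  private
    module P = FinPoset P
    module Q = FinPoset Q
    module QO = IsPartialOrder Q.isPartialOrder
    module PO = IsPartialOrder P.isPartialOrder

  e-injective : ∀ {q q'} → e q ≡ e q' → q ≡ q'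
  e-injective eq = QO.antisym (e-reflects (PO.reflexive eq)) (e-reflects (PO.reflexive (sym eq)))

  e-strict : ∀ {q q'} → q Q.< q' → e q P.< e q'
  e-strict (q≤q' , q≢q') = e-mono q≤q' , q≢q' ∘ e-injective

  e-strict-reflects : ∀ {q q'} → e q P.< e q' → q Q.< q'
  e-strict-reflects (≤ , ≢) = e-reflects ≤ , ≢ ∘ cong e

  module Commuting {B C : Set} (φ : ∣ P ∣ → B) (ψ : ∣ Q ∣ → C) (κ : C → B)
    (κ-injective : ∀ {c c'} → κ c ≡ κ c' → c ≡ c')
    (φ∘e : ∀ q → φ (e q) ≡ κ (ψ q))
    where

    G-pushforward : ∀ {q q'} → G Q ψ q q' → G P φ (e q) (e q')
    G-pushforward (start _) = start refl
    G-pushforward {q} (step {y = y} chain ψy≡ψq y~z) =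
      step (G-pushforward chain) (trans (φ∘e y) (trans (cong κ ψy≡ψq) (sym (φ∘e q))))
           (Sum.map e-strict e-strict y~z)

    G-pullback : ∀ {q z} → G P φ (e q) z → ∃ λ q' → e q' ≡ z × G Q ψ q q'
    G-pullback {q} (start _) = q , refl , start refl
    G-pullback {q} (step chain φy≡ y~z) with G-pullback chain
    ... | q' , refl , chain' with e-closed (Sum.map proj₁ proj₁ y~z)
    ... | q'' , refl =
      q'' , refl , step chain' (κ-injective (trans (sym (φ∘e q'')) (trans φy≡ (φ∘e q))))
                        (Sum.map e-strict-reflects e-strict-reflects y~z)

    G-image : ∀ q → G P φ (e q) ≐ image e (G Q ψ q)
    G-image q z = (λ g → let (q' , eq , g') = G-pullback g in q' , g' , eq)
                , λ { (q' , g' , refl) → G-pushforward g' }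

    module _ (_⊲P_ : Rel ∣ P ∣ 0ℓ) (_⊲Q_ : Rel ∣ Q ∣ 0ℓ)
      (e-⊲         : ∀ {q q'} → q ⊲Q q' → e q ⊲P e q')
      (e-⊲-reflects : ∀ {q q'} → e q ⊲P e q' → q ⊲Q q')
      (⊲-comparable : ∀ {y a} → y ⊲P a → a P.≤ y ⊎ y P.≤ a)
      where

      frontier-pullback : ∀ {q y} → Frontier _⊲P_ (G P φ (e q)) y →
                          ∃ λ q' → e q' ≡ y × Frontier _⊲Q_ (G Q ψ q) q'
      frontier-pullback ((a , ga , y⊲a) , y∉) with G-pullback ga
      ... | qa , refl , ga' with e-closed (⊲-comparable y⊲a)
      ... | q' , refl = q' , refl , (qa , ga' , e-⊲-reflects y⊲a) , y∉ ∘ G-pushforward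

      frontier-pushforward : ∀ {q q'} → Frontier _⊲Q_ (G Q ψ q) q' → Frontier _⊲P_ (G P φ (e q)) (e q')
      frontier-pushforward {q} ((a , ga , q'⊲a) , q'∉) =
        (e a , G-pushforward ga , e-⊲ q'⊲a) ,
        λ g → let (q'' , eq , g') = G-pullback g in q'∉ (subst (G Q ψ q) (e-injective eq) g')

      frontier-image : ∀ q → image φ (Frontier _⊲P_ (G P φ (e q)))
                           ≐ image κ (image ψ (Frontier _⊲Q_ (G Q ψ q)))
      frontier-image q = ≐-trans (image-cong φ frontier≐) (image-square φ∘e)
        where
        frontier≐ : Frontier _⊲P_ (G P φ (e q)) ≐ image e (Frontier _⊲Q_ (G Q ψ q))
        frontier≐ y = (λ f → let (q' , eq , f') = frontier-pullback f in q' , f' , eq)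
                    , λ { (q' , f' , refl) → frontier-pushforward f' }

    evTriple-image : ∀ q → evTriple P φ (e q) ≡₊ mapTriple κ (evTriple Q ψ q)
    evTriple-image q = φ∘e q
                     , frontier-image P._≤_ Q._≤_ e-mono e-reflects inj₂ q
                     , frontier-image (flip P._≤_) (flip Q._≤_) e-mono e-reflects inj₁ q

module _ (𝔓r : RepSystem) {R S : FinPoset} (H : HomScheme 𝔓r R S) where
  open RepSystem 𝔓r
  open HomScheme H

  -- A patch at x identifies the part containing x with a representative on which
  -- φ = κ ∘ h and φ' = κ' ∘ ρ j h, so that G and the EV-triples at x are those at x₀.
  record Patch (P : FinPoset) {B C : Set} (φ : ∣ P ∣ → B) (φ' : ∣ P ∣ → C)
               (κ : ∣ R ∣ → B) (κ' : ∣ S ∣ → C) (x : ∣ P ∣) : Set₁ where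
    field
      j    : Index
      h    : Hom (Rep j) R
      x₀   : ∣ Rep j ∣
      e    : ∣ Rep j ∣ → ∣ P ∣
      G-φ  : G P φ x ≐ image e (G (Rep j) (fun h) x₀)
      G-φ' : G P φ' x ≐ image e (G (Rep j) (fun (ρ j h)) x₀)
      α-φ  : evTriple P φ x ≡₊ mapTriple κ (α (Rep j) R h x₀)
      α-φ' : evTriple P φ' x ≡₊ mapTriple κ' (α (Rep j) S (ρ j h) x₀)

    G-transfer : IsGScheme 𝔓r H → G P φ' x ≐ G P φ x
    G-transfer isG = ≐-trans G-φ' (≐-trans (image-cong e (isG j h x₀)) (≐-sym G-φ))

  I-transfer : IsIScheme 𝔓r H →
               {P P' : FinPoset} {B C : Set}
               {φ : ∣ P ∣ → B} {φ' : ∣ P ∣ → C} {ψ : ∣ P' ∣ → B} {ψ' : ∣ P' ∣ → C}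
               {κ : ∣ R ∣ → B} {κ' : ∣ S ∣ → C} (κ-injective : ∀ {a a'} → κ a ≡ κ a' → a ≡ a')
               {x : ∣ P ∣} {y : ∣ P' ∣} → Patch P φ φ' κ κ' x → Patch P' ψ ψ' κ κ' y →
               (evTriple P φ x ≤₊ evTriple P' ψ y → evTriple P φ' x ≤₊ evTriple P' ψ' y)
             × (evTriple P φ x <₊ evTriple P' ψ y → evTriple P φ' x <₊ evTriple P' ψ' y)
  I-transfer isI {κ' = κ'} κ-injective π π' =
      (λ ≤ → ≤₊-resp-≡₊ (≡₊-sym π.α-φ') (≡₊-sym π'.α-φ') (mapTriple-≤₊ κ' {v} {v'} (proj₁ transfer
               (mapTriple-≤₊-reflects κ-injective {u} {u'} (≤₊-resp-≡₊ π.α-φ π'.α-φ ≤)))))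
    , (λ < → <₊-resp-≡₊ (≡₊-sym π.α-φ') (≡₊-sym π'.α-φ') (mapTriple-<₊ κ' {v} {v'} (proj₂ transfer
               (mapTriple-<₊-reflects κ-injective {u} {u'} (<₊-resp-≡₊ π.α-φ π'.α-φ <)))))
    where
    module π = Patch π
    module π' = Patch π'
    u u' : Triple ∣ R ∣
    u  = α (Rep π.j) R π.h π.x₀
    u' = α (Rep π'.j) R π'.h π'.x₀
    v v' : Triple ∣ S ∣
    v  = α (Rep π.j) S (ρ π.j π.h) π.x₀
    v' = α (Rep π'.j) S (ρ π'.j π'.h) π'.x₀
    transfer : (u ≤₊ u' → v ≤₊ v') × (u <₊ u' → v <₊ v')
    transfer = isI π.j π'.j π.h π'.h π.x₀ π'.x₀

-- Restriction to a summand

module Chart (𝔓r : RepSystem) (P : FinPoset) (w : Selection P) .⦃ _ : NonZero (count w) ⦄ where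
  open RepSystem 𝔓r
  private
    module P = FinPoset P
    module E = Inverse P.enum
    iso : Iso (Rep (proj₁ (cover (subposet P w)))) (subposet P w)
    iso = proj₂ (cover (subposet P w))
    module B = Inverse (Iso.bij iso)

  j : Index
  j = proj₁ (cover (subposet P w))

  e : ∣ Rep j ∣ → ∣ P ∣
  e q = incl P {w} (B.to q)

  e-mono : ∀ {q q'} → FinPoset._≤_ (Rep j) q q' → e q P.≤ e q'
  e-mono = Iso.mono iso

  e-reflects : ∀ {q q'} → e q P.≤ e q' → FinPoset._≤_ (Rep j) q q'
  e-reflects = Iso.reflects iso

  e-selected : ∀ q → Selected P w (e q)
  e-selected q = subst (T ∘ lookup w) (sym (E.strictlyInverseˡ (proj₁ (B.to q)))) (proj₂ (B.to q))

  coordinate : ∀ x → Selected P w x → ∣ Rep j ∣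
  coordinate x t = B.from (E.to x , t)

  e-coordinate : ∀ x t → e (coordinate x t) ≡ x
  e-coordinate x t = trans (cong (incl P {w}) (B.strictlyInverseˡ (E.to x , t))) (E.strictlyInverseʳ x)

  coordinate-e : ∀ q t → coordinate (e q) t ≡ q
  coordinate-e q t = trans (cong B.from (Members-≡ w (E.strictlyInverseˡ _))) (B.strictlyInverseʳ q)

module LeftSummand (𝔓r : RepSystem) {R R' S : FinPoset}
  (H : HomScheme 𝔓r R S) (strong : IsStrong 𝔓r H) where
  open RepSystem 𝔓r
  open HomScheme H

  leftPart : (P : FinPoset) → Hom P (R ⊕ R') → Selection P
  leftPart P ξ = tabulate (isLeft ∘ fun ξ ∘ Inverse.from (FinPoset.enum P))

  leftPart-cong : ∀ {P} (ξ ζ : Hom P (R ⊕ R')) → (∀ x → isLeft (fun ξ x) ≡ isLeft (fun ζ x)) →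
                  leftPart P ξ ≡ leftPart P ζ
  leftPart-cong {P} ξ ζ sameSide = tabulate-cong (sameSide ∘ Inverse.from (FinPoset.enum P))

  module _ {P : FinPoset} {w : Selection P} (ξ : Hom P (R ⊕ R')) (p : leftPart P ξ ≡ w) where
    private module E = Inverse (FinPoset.enum P)

    lookup-leftPart : ∀ x → lookup w (E.to x) ≡ isLeft (fun ξ x)
    lookup-leftPart x = begin
      lookup w (E.to x)                  ≡⟨ cong (λ v → lookup v (E.to x)) p ⟨
      lookup (leftPart P ξ) (E.to x)     ≡⟨ lookup∘tabulate (isLeft ∘ fun ξ ∘ E.from) (E.to x) ⟩
      isLeft (fun ξ (E.from (E.to x)))   ≡⟨ cong (isLeft ∘ fun ξ) (E.strictlyInverseʳ x) ⟩
      isLeft (fun ξ x)                   ∎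
      where open ≡-Reasoning

    selected : ∀ {x} → T (isLeft (fun ξ x)) → Selected P w x
    selected = subst T (sym (lookup-leftPart _))

    selected⁻¹ : ∀ {x} → Selected P w x → T (isLeft (fun ξ x))
    selected⁻¹ = subst T (lookup-leftPart _)

    nonZero : ∀ {x} → T (isLeft (fun ξ x)) → NonZero (count w)
    nonZero t = nonZeroIndex (Inverse.to (Members↔count w) (_ , selected t))

  module Restriction {P : FinPoset} {w : Selection P} .⦃ nonZero-w : NonZero (count w) ⦄
    (ξ : Hom P (R ⊕ R')) (p : leftPart P ξ ≡ w) where
    open Chart 𝔓r P w ⦃ nonZero-w ⦄ public
    private module P = FinPoset P

    isLeft-e : ∀ q → T (isLeft (fun ξ (e q)))
    isLeft-e q = selected⁻¹ ξ p (e-selected q)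

    h : Hom (Rep j) R
    h = record { fun  = λ q → fromLeft (fun ξ (e q)) (isLeft-e q)
               ; mono = λ q≤q' → fromLeft-mono (Hom.mono ξ (e-mono q≤q')) _ _ }

    ξ∘e : ∀ q → fun ξ (e q) ≡ inj₁ (fun h q)
    ξ∘e q = sym (inj₁-fromLeft _ _)

    e-closed : ∀ {q y} → e q P.≤ y ⊎ y P.≤ e q → ∃ λ q' → e q' ≡ y
    e-closed {q} {y} comparable = coordinate y y∈w , e-coordinate y y∈w
      where
      y∈w : Selected P w y
      y∈w = selected ξ p (subst T (isLeft-comparable ξ comparable) (isLeft-e q))

    value : ∀ x → T (isLeft (fun ξ x)) → ∣ S ∣
    value x t = fun (ρ j h) (coordinate x (selected ξ p t))

    value-e : ∀ q t → value (e q) t ≡ fun (ρ j h) q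
    value-e q t = cong (fun (ρ j h)) (coordinate-e q _)

    value-mono : ∀ {x y} → x P.≤ y → (t : T (isLeft (fun ξ x))) (t' : T (isLeft (fun ξ y))) →
                 FinPoset._≤_ S (value x t) (value y t')
    value-mono {x} {y} x≤y t t' = Hom.mono (ρ j h)
      (e-reflects (subst₂ P._≤_ (sym (e-coordinate x _)) (sym (e-coordinate y _)) x≤y))

  module _ {P : FinPoset} {w : Selection P} .⦃ nonZero-w : NonZero (count w) ⦄ {ξ ζ : Hom P (R ⊕ R')}
    (p : leftPart P ξ ≡ w) (p' : leftPart P ζ ≡ w) where
    open Chart 𝔓r P w ⦃ nonZero-w ⦄
    private
      module Rξ = Restriction ξ p
      module Rζ = Restriction ζ p'

    restricted-cong : ξ ≗ₕ ζ → ∀ x t t' → Rξ.value x t ≡ Rζ.value x t'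
    restricted-cong ξ≗ζ x t t' =
      trans (cong (fun (ρ j Rξ.h) ∘ coordinate x) (T-irrelevant _ _)) (ρ-wd j Rξ.h Rζ.h h≗ _)
      where
      h≗ : Rξ.h ≗ₕ Rζ.h
      h≗ q = inj₁-injective (trans (sym (Rξ.ξ∘e q)) (trans (ξ≗ζ (e q)) (Rζ.ξ∘e q)))

    restricted-injective : (∀ x t t' → Rξ.value x t ≡ Rζ.value x t') →
                           ∀ x → T (isLeft (fun ξ x)) → fun ξ x ≡ fun ζ x
    restricted-injective agree x t =
      subst (λ y → fun ξ y ≡ fun ζ y) (e-coordinate x (selected ξ p t)) (ξ∘e≗ζ∘e _)
      where
      ρh≗ : ρ j Rξ.h ≗ₕ ρ j Rζ.h
      ρh≗ q = trans (sym (Rξ.value-e q _))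
                    (trans (agree (e q) (Rξ.isLeft-e q) (Rζ.isLeft-e q)) (Rζ.value-e q _))
      ξ∘e≗ζ∘e : ∀ q → fun ξ (e q) ≡ fun ζ (e q)
      ξ∘e≗ζ∘e q = trans (Rξ.ξ∘e q) (trans (cong inj₁ (strong j Rξ.h Rζ.h ρh≗ q)) (sym (Rζ.ξ∘e q)))

  module _ {P : FinPoset} {w : Selection P} where

    value : (ξ : Hom P (R ⊕ R')) → leftPart P ξ ≡ w → ∀ x → T (isLeft (fun ξ x)) → ∣ S ∣
    value ξ p x t = Restriction.value ⦃ nonZero ξ p t ⦄ ξ p x t

    value-mono : (ξ : Hom P (R ⊕ R')) (p : leftPart P ξ ≡ w) → ∀ {x y} → FinPoset._≤_ P x y →
                 (t : T (isLeft (fun ξ x))) (t' : T (isLeft (fun ξ y))) →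
                 FinPoset._≤_ S (value ξ p x t) (value ξ p y t')
    value-mono ξ p x≤y t = Restriction.value-mono ⦃ nonZero ξ p t ⦄ ξ p x≤y t

    value-cong : (ξ ζ : Hom P (R ⊕ R')) (p : leftPart P ξ ≡ w) (p' : leftPart P ζ ≡ w) → ξ ≗ₕ ζ →
                 ∀ x t t' → value ξ p x t ≡ value ζ p' x t'
    value-cong ξ ζ p p' ξ≗ζ x t = restricted-cong ⦃ nonZero ξ p t ⦄ {ξ} {ζ} p p' ξ≗ζ x t

    value-injective : (ξ ζ : Hom P (R ⊕ R')) (p : leftPart P ξ ≡ w) (p' : leftPart P ζ ≡ w) →
                      (∀ x t t' → value ξ p x t ≡ value ζ p' x t') →
                      ∀ x → T (isLeft (fun ξ x)) → fun ξ x ≡ fun ζ x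
    value-injective ξ ζ p p' agree x t = restricted-injective ⦃ nonZero ξ p t ⦄ {ξ} {ζ} p p' agree x t

  module _ {P : FinPoset} (ξ : Hom P (R ⊕ R')) {B C : Set}
    {φ : ∣ P ∣ → B} {κ : ∣ R ∣ → B} (κ-injective : ∀ {a a'} → κ a ≡ κ a' → a ≡ a')
    (φ-spec : ∀ {y a} → fun ξ y ≡ inj₁ a → φ y ≡ κ a)
    {φ' : ∣ P ∣ → C} {κ' : ∣ S ∣ → C} (κ'-injective : ∀ {b b'} → κ' b ≡ κ' b' → b ≡ b')
    (φ'-spec : ∀ y t → φ' y ≡ κ' (value ξ refl y t))
    where

    patch : ∀ x → T (isLeft (fun ξ x)) → Patch 𝔓r H P φ φ' κ κ' x
    patch x t = subst (Patch 𝔓r H P φ φ' κ κ') (e-coordinate x (selected ξ refl t))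
                      (patchAt (coordinate x (selected ξ refl t)))
      where
      open Restriction ⦃ nonZero ξ refl t ⦄ ξ refl
      module E = ComponentEmbedding P (Rep j) e e-mono e-reflects e-closed
      module Eφ = E.Commuting φ (fun h) κ κ-injective (φ-spec ∘ ξ∘e)
      module Eφ' = E.Commuting φ' (fun (ρ j h)) κ' κ'-injective
                     (λ q → trans (φ'-spec (e q) (isLeft-e q)) (cong κ' (value-e q _)))

      patchAt : ∀ q → Patch 𝔓r H P φ φ' κ κ' (e q)
      patchAt q = record
        { j = j ; h = h ; x₀ = q ; e = e
        ; G-φ = Eφ.G-image q ; G-φ' = Eφ'.G-image q
        ; α-φ = Eφ.evTriple-image q ; α-φ' = Eφ'.evTriple-image q
        }

-- The direct sum of Hom-schemes

module DirectSum (𝔓r : RepSystem) {R¹ R² S¹ S² : FinPoset}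
  (H₁ : HomScheme 𝔓r R¹ S¹) (strong₁ : IsStrong 𝔓r H₁)
  (H₂ : HomScheme 𝔓r R² S²) (strong₂ : IsStrong 𝔓r H₂) where
  open RepSystem 𝔓r
  private
    module L₁ = LeftSummand 𝔓r {R' = R²} H₁ strong₁
    -- R² is handled as the left summand of swap ∘ ξ.
    module L₂ = LeftSummand 𝔓r {R' = R¹} H₂ strong₂

  module Glue {P : FinPoset} (ξ : Hom P (R¹ ⊕ R²)) {w₁ w₂ : Selection P}
    (p₁ : L₁.leftPart P ξ ≡ w₁) (p₂ : L₂.leftPart P (swapHom ξ) ≡ w₂) where
    private module P = FinPoset P

    -- Kept abstract: glue is only used through glue-inj₁/₂, and unfolding it is very costly.
    abstract
      glue : ∣ P ∣ → ∣ S¹ ⊕ S² ∣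
      glue x = [ (λ t → inj₁ (L₁.value ξ p₁ x t)) , (λ t → inj₂ (L₂.value (swapHom ξ) p₂ x t)) ]′
                 (isLeft⊎isLeft-swap (fun ξ x))

      glue-inj₁ : ∀ x t → glue x ≡ inj₁ (L₁.value ξ p₁ x t)
      glue-inj₁ x t with isLeft⊎isLeft-swap (fun ξ x)
      ... | inj₁ t' = cong (inj₁ ∘ L₁.value ξ p₁ x) (T-irrelevant t' t)
      ... | inj₂ t' = ⊥-elim (¬isLeft×isLeft-swap (fun ξ x) t t')

      glue-inj₂ : ∀ x t → glue x ≡ inj₂ (L₂.value (swapHom ξ) p₂ x t)
      glue-inj₂ x t with isLeft⊎isLeft-swap (fun ξ x)
      ... | inj₁ t' = ⊥-elim (¬isLeft×isLeft-swap (fun ξ x) t' t)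
      ... | inj₂ t' = cong (inj₂ ∘ L₂.value (swapHom ξ) p₂ x) (T-irrelevant t' t)

    glue-mono : ∀ {x y} → x P.≤ y → FinPoset._≤_ (S¹ ⊕ S²) (glue x) (glue y)
    glue-mono {x} {y} x≤y = [ onLeft , onRight ]′ (isLeft⊎isLeft-swap (fun ξ x))
      where
      onLeft : T (isLeft (fun ξ x)) → FinPoset._≤_ (S¹ ⊕ S²) (glue x) (glue y)
      onLeft t = subst₂ (FinPoset._≤_ (S¹ ⊕ S²)) (sym (glue-inj₁ x t)) (sym (glue-inj₁ y t'))
                   (le₁ (L₁.value-mono ξ p₁ x≤y t t'))
        where
        t' : T (isLeft (fun ξ y))
        t' = subst T (isLeft-comparable ξ (inj₁ x≤y)) t
      onRight : T (isLeft (swap (fun ξ x))) → FinPoset._≤_ (S¹ ⊕ S²) (glue x) (glue y)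
      onRight t = subst₂ (FinPoset._≤_ (S¹ ⊕ S²)) (sym (glue-inj₂ x t)) (sym (glue-inj₂ y t'))
                    (le₂ (L₂.value-mono (swapHom ξ) p₂ x≤y t t'))
        where
        t' : T (isLeft (swap (fun ξ y)))
        t' = subst T (isLeft-comparable (swapHom ξ) (inj₁ x≤y)) t

    isLeft-glue : ∀ x → isLeft (glue x) ≡ isLeft (fun ξ x)
    isLeft-glue x = [ (λ t → trans (cong isLeft (glue-inj₁ x t)) (sym (isLeft-true t)))
                    , (λ t → trans (cong isLeft (glue-inj₂ x t)) (sym (isLeft-swap-true t))) ]′
                    (isLeft⊎isLeft-swap (fun ξ x))

    glueHom : Hom P (S¹ ⊕ S²)
    glueHom = record { fun = glue ; mono = glue-mono }

  module _ {P : FinPoset} {w₁ w₂ : Selection P} where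
    open Glue

    glue-canonical : (ξ : Hom P (R¹ ⊕ R²))
                     (p₁ : L₁.leftPart P ξ ≡ w₁) (p₂ : L₂.leftPart P (swapHom ξ) ≡ w₂) →
                     ∀ x → glue ξ p₁ p₂ x ≡ glue ξ refl refl x
    glue-canonical ξ refl refl x = refl

    module _ (ξ ζ : Hom P (R¹ ⊕ R²))
      (p₁ : L₁.leftPart P ξ ≡ w₁) (p₂ : L₂.leftPart P (swapHom ξ) ≡ w₂)
      (p₁' : L₁.leftPart P ζ ≡ w₁) (p₂' : L₂.leftPart P (swapHom ζ) ≡ w₂) where

      glue-cong : ξ ≗ₕ ζ → ∀ x → glue ξ p₁ p₂ x ≡ glue ζ p₁' p₂' x
      glue-cong ξ≗ζ x = [ onLeft , onRight ]′ (isLeft⊎isLeft-swap (fun ξ x))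
        where
        open ≡-Reasoning
        onLeft : T (isLeft (fun ξ x)) → glue ξ p₁ p₂ x ≡ glue ζ p₁' p₂' x
        onLeft t = begin
          glue ξ p₁ p₂ x             ≡⟨ glue-inj₁ ξ p₁ p₂ x t ⟩
          inj₁ (L₁.value ξ p₁ x t)   ≡⟨ cong inj₁ (L₁.value-cong ξ ζ p₁ p₁' ξ≗ζ x t t') ⟩
          inj₁ (L₁.value ζ p₁' x t') ≡⟨ glue-inj₁ ζ p₁' p₂' x t' ⟨
          glue ζ p₁' p₂' x           ∎
          where
          t' : T (isLeft (fun ζ x))
          t' = subst (T ∘ isLeft) (ξ≗ζ x) t
        onRight : T (isLeft (swap (fun ξ x))) → glue ξ p₁ p₂ x ≡ glue ζ p₁' p₂' x
        onRight t = begin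
          glue ξ p₁ p₂ x                       ≡⟨ glue-inj₂ ξ p₁ p₂ x t ⟩
          inj₂ (L₂.value (swapHom ξ) p₂ x t)
            ≡⟨ cong inj₂ (L₂.value-cong (swapHom ξ) (swapHom ζ) p₂ p₂' (cong swap ∘ ξ≗ζ) x t t') ⟩
          inj₂ (L₂.value (swapHom ζ) p₂' x t') ≡⟨ glue-inj₂ ζ p₁' p₂' x t' ⟨
          glue ζ p₁' p₂' x                     ∎
          where
          t' : T (isLeft (swap (fun ζ x)))
          t' = subst (T ∘ isLeft ∘ swap) (ξ≗ζ x) t

      glue-injective : (∀ x → glue ξ p₁ p₂ x ≡ glue ζ p₁' p₂' x) → ξ ≗ₕ ζ
      glue-injective agree x with isLeft⊎isLeft-swap (fun ξ x)
      ... | inj₁ t = L₁.value-injective ξ ζ p₁ p₁' agree₁ x t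
        where
        agree₁ : ∀ y u u' → L₁.value ξ p₁ y u ≡ L₁.value ζ p₁' y u'
        agree₁ y u u' = inj₁-injective
          (trans (sym (glue-inj₁ ξ p₁ p₂ y u)) (trans (agree y) (glue-inj₁ ζ p₁' p₂' y u')))
      ... | inj₂ t = swap-injective (L₂.value-injective (swapHom ξ) (swapHom ζ) p₂ p₂' agree₂ x t)
        where
        agree₂ : ∀ y u u' → L₂.value (swapHom ξ) p₂ y u ≡ L₂.value (swapHom ζ) p₂' y u'
        agree₂ y u u' = inj₂-injective
          (trans (sym (glue-inj₂ ξ p₁ p₂ y u)) (trans (agree y) (glue-inj₂ ζ p₁' p₂' y u')))

  module _ {P : FinPoset} (ξ ζ : Hom P (R¹ ⊕ R²))
    (sameSide : ∀ x → isLeft (fun ζ x) ≡ isLeft (fun ξ x)) where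

    leftPart₁-cong : L₁.leftPart P ζ ≡ L₁.leftPart P ξ
    leftPart₁-cong = L₁.leftPart-cong ζ ξ sameSide

    leftPart₂-cong : L₂.leftPart P (swapHom ζ) ≡ L₂.leftPart P (swapHom ξ)
    leftPart₂-cong = L₂.leftPart-cong (swapHom ζ) (swapHom ξ) λ x →
      trans (isLeft-swap (fun ζ x)) (trans (cong not (sameSide x)) (sym (isLeft-swap (fun ξ x))))

  ρ⊕ : (i : Index) → Hom (Rep i) (R¹ ⊕ R²) → Hom (Rep i) (S¹ ⊕ S²)
  ρ⊕ i ξ = Glue.glueHom ξ refl refl

  ρ⊕-cong : (i : Index) (ξ ζ : Hom (Rep i) (R¹ ⊕ R²)) → ξ ≗ₕ ζ → ρ⊕ i ξ ≗ₕ ρ⊕ i ζ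
  ρ⊕-cong i ξ ζ ξ≗ζ x = trans (glue-cong ξ ζ refl refl p₁ p₂ ξ≗ζ x) (glue-canonical ζ p₁ p₂ x)
    where
    p₁ : L₁.leftPart (Rep i) ζ ≡ L₁.leftPart (Rep i) ξ
    p₁ = leftPart₁-cong ξ ζ (λ y → cong isLeft (sym (ξ≗ζ y)))
    p₂ : L₂.leftPart (Rep i) (swapHom ζ) ≡ L₂.leftPart (Rep i) (swapHom ξ)
    p₂ = leftPart₂-cong ξ ζ (λ y → cong isLeft (sym (ξ≗ζ y)))

  scheme : HomScheme 𝔓r (R¹ ⊕ R²) (S¹ ⊕ S²)
  scheme = record { ρ = ρ⊕ ; ρ-wd = ρ⊕-cong }

  scheme-strong : IsStrong 𝔓r scheme
  scheme-strong i ξ ζ ρξ≗ρζ =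
    glue-injective ξ ζ refl refl p₁ p₂ λ x → trans (ρξ≗ρζ x) (sym (glue-canonical ζ p₁ p₂ x))
    where
    sameSide : ∀ x → isLeft (fun ζ x) ≡ isLeft (fun ξ x)
    sameSide x = begin
      isLeft (fun ζ x)              ≡⟨ Glue.isLeft-glue ζ refl refl x ⟨
      isLeft (fun (ρ⊕ i ζ) x)       ≡⟨ cong isLeft (ρξ≗ρζ x) ⟨
      isLeft (fun (ρ⊕ i ξ) x)       ≡⟨ Glue.isLeft-glue ξ refl refl x ⟩
      isLeft (fun ξ x)              ∎
      where open ≡-Reasoning
    p₁ : L₁.leftPart (Rep i) ζ ≡ L₁.leftPart (Rep i) ξ
    p₁ = leftPart₁-cong ξ ζ sameSide
    p₂ : L₂.leftPart (Rep i) (swapHom ζ) ≡ L₂.leftPart (Rep i) (swapHom ξ)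
    p₂ = leftPart₂-cong ξ ζ sameSide

  patch : ∀ i (ξ : Hom (Rep i) (R¹ ⊕ R²)) x →
          Patch 𝔓r H₁ (Rep i) (fun ξ) (fun (ρ⊕ i ξ)) inj₁ inj₁ x
        ⊎ Patch 𝔓r H₂ (Rep i) (fun ξ) (fun (ρ⊕ i ξ)) inj₂ inj₂ x
  patch i ξ x = Sum.map
    (L₁.patch ξ inj₁-injective id inj₁-injective (Glue.glue-inj₁ ξ refl refl) x)
    (L₂.patch (swapHom ξ) inj₂-injective swap-injective inj₂-injective (Glue.glue-inj₂ ξ refl refl) x)
    (isLeft⊎isLeft-swap (fun ξ x))

  scheme-G : IsGScheme 𝔓r H₁ → IsGScheme 𝔓r H₂ → IsGScheme 𝔓r scheme
  scheme-G isG₁ isG₂ i ξ x =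
    [ (λ π → Patch.G-transfer π isG₁) , (λ π → Patch.G-transfer π isG₂) ]′ (patch i ξ x)

  scheme-I : IsIScheme 𝔓r H₁ → IsIScheme 𝔓r H₂ → IsIScheme 𝔓r scheme
  scheme-I isI₁ isI₂ i i' ξ ζ x y with patch i ξ x | patch i' ζ y
  ... | inj₁ π | inj₁ π' = I-transfer 𝔓r H₁ isI₁ inj₁-injective π π'
  ... | inj₂ π | inj₂ π' = I-transfer 𝔓r H₂ isI₂ inj₂-injective π π'
  ... | inj₁ π | inj₂ π' = incomparable (≤₊-disjoint (λ _ _ ()) (Patch.α-φ π) (Patch.α-φ π'))
  ... | inj₂ π | inj₁ π' = incomparable (≤₊-disjoint (λ _ _ ()) (Patch.α-φ π) (Patch.α-φ π'))

proposition3 : (𝔓r : RepSystem) (R¹ R² S¹ S² : FinPoset)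
    → (_⊑_ 𝔓r R¹ S¹ → _⊑_ 𝔓r R² S² → _⊑_ 𝔓r (R¹ ⊕ R²) (S¹ ⊕ S²))
    × (_⊑G_ 𝔓r R¹ S¹ → _⊑G_ 𝔓r R² S² → _⊑G_ 𝔓r (R¹ ⊕ R²) (S¹ ⊕ S²))
    × (_⊑I_ 𝔓r R¹ S¹ → _⊑I_ 𝔓r R² S² → _⊑I_ 𝔓r (R¹ ⊕ R²) (S¹ ⊕ S²))
proposition3 𝔓r R¹ R² S¹ S² =
    (λ { (H₁ , s₁) (H₂ , s₂) → let open DirectSum 𝔓r H₁ s₁ H₂ s₂ in
           scheme , scheme-strong })
  , (λ { (H₁ , s₁ , g₁) (H₂ , s₂ , g₂) → let open DirectSum 𝔓r H₁ s₁ H₂ s₂ in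
           scheme , scheme-strong , scheme-G g₁ g₂ })
  , (λ { (H₁ , s₁ , i₁) (H₂ , s₂ , i₂) → let open DirectSum 𝔓r H₁ s₁ H₂ s₂ in
           scheme , scheme-strong , scheme-I i₁ i₂ })
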